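{- Let $D\ge1$ and $d\ge1$ be integers and let $a_1,\dots,a_d$ be integers. There exists an integer $t$ such that, for every $i\in\{1,\dots,d\}$, the remainder of the Euclidean division of $-(t+a_i)$ by $D$ is either $0$ or at least $\frac Dd$. -}

module Defs where

{-# OPTIONS --safe #-}
module Submission where

-- If every shift t ∈ {0, …, D − 1} were bad, each t would have an index i whose
-- residue r = −(t + aᵢ) mod D satisfies 1 ≤ r ≤ ⌊(D − 1)/d⌋.  The map t ↦ (i, r)
-- is injective, because for fixed i the residues of D consecutive shifts are
-- pairwise distinct; so D ≤ d ⌊(D − 1)/d⌋ ≤ D − 1 by the pigeonhole principle.

open import Defs
open import Data.Nat using (ℕ; NonZero; _≤_; _*_; zero)
open import Data.Integer using (ℤ; +_; -_; _+_; _%ℕ_)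
open import Data.Fin using (Fin)
open import Data.Product using (∃)
open import Data.Sum using (_⊎_)
open import Relation.Binary.PropositionalEquality using (_≡_)

open import Data.Nat as ℕ using (suc; pred; _<_; _≟_; _≤?_; >-nonZero; ≢-nonZero)
open import Data.Nat.Properties as ℕ
  using (<⇒≤pred; pred-injective; m≤pred[n]⇒suc[m]≤n; <-≤-trans; <-irrefl; ≰⇒>; ⊔-lub; m≤m+n)
open import Data.Nat.DivMod using (_/_; m*n/n≡m; /-monoˡ-≤; m/n*n≤m)
open import Data.Integer as ℤ using (0ℤ; _-_; _/ℕ_; ∣_∣)
open import Data.Integer.Properties
  using (+-injective; neg-injective; i≡j⇒i-j≡0; i-j≡0⇒i≡j; ∣i∣≡0⇒i≡0; ∣i*j∣≡∣i∣*∣j∣; ∣-i∣≡∣i∣; ∣m⊝n∣≤m⊔n; [+m]-[+n]≡m⊖n)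
open import Data.Integer.DivMod using (a≡a%ℕn+[a/ℕn]*n)
open import Data.Integer.Solver using (module +-*-Solver)
open import Data.Fin using (toℕ; fromℕ<; combine)
open import Data.Fin.Properties
  using (toℕ<n; toℕ-injective; toℕ-fromℕ<; combine-injective; injective⇒≤; any?; all?; ¬∀⟶∃¬)
open import Data.Product using (_,_; proj₁; proj₂)
open import Data.Sum using (inj₁; inj₂)
open import Data.Empty using (⊥)
open import Relation.Nullary using (¬_; Dec; yes; no; contradiction)
open import Relation.Nullary.Decidable using (_⊎-dec_)
open import Relation.Binary.PropositionalEquality using (refl; sym; trans; cong; cong₂; subst; module ≡-Reasoning)

open +-*-Solver

i%n≡j%n⇒i-j≡[i/n-j/n]*n : ∀ i j n .{{_ : NonZero n}} → i %ℕ n ≡ j %ℕ n → i - j ≡ (i /ℕ n - j /ℕ n) ℤ.* + n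
i%n≡j%n⇒i-j≡[i/n-j/n]*n i j n i%n≡j%n = begin
  i - j                                   ≡⟨ cong₂ _-_ (a≡a%ℕn+[a/ℕn]*n i n) (a≡a%ℕn+[a/ℕn]*n j n) ⟩
  (+ i%n + p ℤ.* + n) - (+ r + q ℤ.* + n) ≡⟨ cong (λ s → (+ s + p ℤ.* + n) - (+ r + q ℤ.* + n)) i%n≡j%n ⟩
  (+ r + p ℤ.* + n) - (+ r + q ℤ.* + n)   ≡⟨ solve 4 (λ r p q n → (r :+ p :* n) :- (r :+ q :* n) := (p :- q) :* n)
                                                    refl (+ r) p q (+ n) ⟩
  (p - q) ℤ.* + n                         ∎
  where
  open ≡-Reasoning
  i%n = i %ℕ n
  r = j %ℕ n
  p = i /ℕ n
  q = j /ℕ n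

∣q*n∣<n⇒q≡0 : ∀ q {n} → ∣ q ℤ.* + n ∣ < n → q ≡ 0ℤ
∣q*n∣<n⇒q≡0 q {n} ∣qn∣<n with ∣ q ∣ in ∣q∣≡ | ∣i*j∣≡∣i∣*∣j∣ q (+ n)
... | zero  | _      = ∣i∣≡0⇒i≡0 ∣q∣≡
... | suc k | ∣qn∣≡ = contradiction (<-≤-trans ∣qn∣<n (subst (n ≤_) (sym ∣qn∣≡) (m≤m+n n (k * n)))) (<-irrefl refl)

∣i-j∣<n⇒i%n≡j%n⇒i≡j : ∀ i j {n} .{{_ : NonZero n}} → ∣ i - j ∣ < n → i %ℕ n ≡ j %ℕ n → i ≡ j
∣i-j∣<n⇒i%n≡j%n⇒i≡j i j {n} ∣i-j∣<n i%n≡j%n =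
  i-j≡0⇒i≡j i j (trans i-j≡qn (cong (ℤ._* + n) (∣q*n∣<n⇒q≡0 q (subst (λ k → ∣ k ∣ < n) i-j≡qn ∣i-j∣<n))))
  where
  q = i /ℕ n - j /ℕ n
  i-j≡qn : i - j ≡ q ℤ.* + n
  i-j≡qn = i%n≡j%n⇒i-j≡[i/n-j/n]*n i j n i%n≡j%n

m*n<o⇒pred[m]<pred[o]/n : ∀ m {n o} .{{_ : NonZero m}} .{{_ : NonZero n}} → m * n < o → pred m < pred o / n
m*n<o⇒pred[m]<pred[o]/n (suc m) {n} m*n<o = subst (_≤ _) (m*n/n≡m (suc m) n) (/-monoˡ-≤ n (<⇒≤pred m*n<o))

module _ (D : ℕ) .{{_ : NonZero D}} {d : ℕ} .{{_ : NonZero d}} (a : Fin d → ℤ) where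

  residue : Fin D → Fin d → ℕ
  residue t i = (- (+ toℕ t + a i)) %ℕ D

  Good : Fin D → Fin d → Set
  Good t i = (residue t i ≡ 0) ⊎ (D ≤ residue t i * d)

  good? : ∀ t i → Dec (Good t i)
  good? t i = (residue t i ≟ 0) ⊎-dec (D ≤? residue t i * d)

  residue-injective : ∀ i {t u} → residue t i ≡ residue u i → t ≡ u
  residue-injective i {t} {u} rt≡ru =
    toℕ-injective (+-injective (i-j≡0⇒i≡j (+ toℕ t) (+ toℕ u)
      (neg-injective (trans shift (i≡j⇒i-j≡0 (∣i-j∣<n⇒i%n≡j%n⇒i≡j x y distance<D rt≡ru))))))
    where
    x y : ℤ
    x = - (+ toℕ t + a i)
    y = - (+ toℕ u + a i)
    shift : - (+ toℕ t - + toℕ u) ≡ x - y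
    shift = solve 3 (λ t u x → :- (t :- u) := (:- (t :+ x)) :- (:- (u :+ x))) refl (+ toℕ t) (+ toℕ u) (a i)
    distance<D : ∣ x - y ∣ < D
    distance<D = begin-strict
      ∣ x - y ∣                                 ≡⟨ cong ∣_∣ shift ⟨
      ∣ - (+ toℕ t - + toℕ u) ∣                 ≡⟨ ∣-i∣≡∣i∣ (+ toℕ t - + toℕ u) ⟩
      ∣ + toℕ t - + toℕ u ∣                     ≡⟨ cong ∣_∣ ([+m]-[+n]≡m⊖n (toℕ t) (toℕ u)) ⟩
      ∣ toℕ t ℤ.⊖ toℕ u ∣                       ≤⟨ ∣m⊝n∣≤m⊔n (toℕ t) (toℕ u) ⟩
      toℕ t ℕ.⊔ toℕ u                           <⟨ ⊔-lub (toℕ<n t) (toℕ<n u) ⟩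
      D                                         ∎
      where open ℕ.≤-Reasoning

  module _ (bad : ∀ t → ∃ λ i → ¬ Good t i) where

    witness : Fin D → Fin d
    witness t = proj₁ (bad t)

    residue≢0 : ∀ t → ¬ residue t (witness t) ≡ 0
    residue≢0 t r≡0 = proj₂ (bad t) (inj₁ r≡0)

    pred[residue]<pred[D]/d : ∀ t → pred (residue t (witness t)) < pred D / d
    pred[residue]<pred[D]/d t = m*n<o⇒pred[m]<pred[o]/n _ {{≢-nonZero (residue≢0 t)}}
      (≰⇒> (λ D≤rd → proj₂ (bad t) (inj₂ D≤rd)))

    encode : Fin D → Fin (d * (pred D / d))
    encode t = combine (witness t) (fromℕ< (pred[residue]<pred[D]/d t))

    encode-injective : ∀ {t u} → encode t ≡ encode u → t ≡ u
    encode-injective {t} {u} eq with combine-injective (witness t) _ (witness u) _ eq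
    ... | i≡j , k≡l = residue-injective (witness t) (trans rt≡ru (cong (residue u) (sym i≡j)))
      where
      rt≡ru : residue t (witness t) ≡ residue u (witness u)
      rt≡ru = pred-injective {{≢-nonZero (residue≢0 t)}} {{≢-nonZero (residue≢0 u)}} (begin
        pred (residue t (witness t))             ≡⟨ toℕ-fromℕ< (pred[residue]<pred[D]/d t) ⟨
        toℕ (fromℕ< (pred[residue]<pred[D]/d t)) ≡⟨ cong toℕ k≡l ⟩
        toℕ (fromℕ< (pred[residue]<pred[D]/d u)) ≡⟨ toℕ-fromℕ< (pred[residue]<pred[D]/d u) ⟩
        pred (residue u (witness u))             ∎)
        where open ≡-Reasoning

    pigeonhole : ⊥
    pigeonhole = <-irrefl refl (m≤pred[n]⇒suc[m]≤n (begin
      D                ≤⟨ injective⇒≤ encode-injective ⟩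
      d * (pred D / d) ≡⟨ ℕ.*-comm d (pred D / d) ⟩
      pred D / d * d   ≤⟨ m/n*n≤m (pred D) d ⟩
      pred D           ∎))
      where open ℕ.≤-Reasoning

  good-shift : ∃ λ t → ∀ i → Good t i
  good-shift with any? (λ t → all? (good? t))
  ... | yes found = found
  ... | no none   = contradiction (λ t → ¬∀⟶∃¬ d (Good t) (good? t) (λ all-good → none (t , all-good))) pigeonhole

mainTheorem11 : (D : ℕ) → .{{_ : NonZero D}} → (d : ℕ) → 1 ≤ d → (a : Fin d → ℤ) →
    ∃ λ (t : ℤ) → ∀ (i : Fin d) →
    ((- (t + a i)) %ℕ D ≡ 0) ⊎ (D ≤ ((- (t + a i)) %ℕ D) * d)
mainTheorem11 D d 1≤d a with good-shift D {{_}} {{>-nonZero 1≤d}} a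
... | t , good = + toℕ t , good
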